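{- There is a uniformly primitive recursive sequence $(V_n)_{n\in\omega}$ of dense open sets in $\omega^{\omega}$ such that no primitive recursive function $f\in\omega^\omega$ lies in $\bigcap_n V_n$.
   Context: For $\sigma\in\omega^{<\omega}$, the basic open set $B_\sigma$ consists of all elements of $\omega^\omega$ extending $\sigma$. An open set is given by a listing of finite strings $\sigma$ (i.e., basic open sets $B_\sigma$) whose union is the set; a sequence $(V_n)$ is uniformly primitive recursive if there is a primitive recursive function of two arguments whose $n$-th row lists the basic open sets composing $V_n$. An open set $V$ is dense if every string has an extension lying in a basic open subset of $V$. -}

module Defs where

open import Data.Nat using (ℕ; zero; suc; _<_)
open import Data.Nat.DivMod using (_/_; _%_)
open import Data.Fin using (Fin)
open import Data.Vec using (Vec; []; _∷_; lookup)
open import Data.List using (List; []; _∷_; length; map; upTo)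
open import Data.Product using (Σ; ∃; _×_; _,_)
open import Relation.Binary.PropositionalEquality using (_≡_)

data PR : ℕ → Set where
  zeroF : ∀ {n} → PR n
  succF : PR 1
  proj  : ∀ {n} → Fin n → PR n
  comp  : ∀ {m n} → PR m → Vec (PR n) m → PR n
  prec  : ∀ {n} → PR n → PR (suc (suc n)) → PR (suc n)

mutual
  eval : ∀ {n} → PR n → Vec ℕ n → ℕ
  eval zeroF xs = 0
  eval succF (x ∷ []) = suc x
  eval (proj i) xs = lookup xs i
  eval (comp f gs) xs = eval f (evalAll gs xs)
  eval (prec g h) (zero ∷ xs) = eval g xs
  eval (prec g h) (suc y ∷ xs) = eval h (y ∷ eval (prec g h) (y ∷ xs) ∷ xs)

  evalAll : ∀ {m n} → Vec (PR n) m → Vec ℕ n → Vec ℕ m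
  evalAll [] xs = []
  evalAll (g ∷ gs) xs = eval g xs ∷ evalAll gs xs

IsPrimRec : (ℕ → ℕ) → Set
IsPrimRec f = Σ (PR 1) λ p → ∀ x → eval p (x ∷ []) ≡ f x

-- Coding of strings ω^{<ω} by natural numbers (a standard bijection):
--   code [] = 0,  code (a ∷ σ) = 2^a * (2 * code σ + 1)

-- 2-adic valuation and odd part, with fuel
val2 : ℕ → ℕ → ℕ × ℕ
val2 zero m = 0 , m
val2 (suc k) zero = 0 , 0
val2 (suc k) (suc m) with suc m % 2
... | zero with val2 k (suc m / 2)
...   | a , o = suc a , o
val2 (suc k) (suc m) | suc _ = 0 , suc m

decodeF : ℕ → ℕ → List ℕ
decodeF zero n = []
decodeF (suc k) zero = []
decodeF (suc k) (suc n) with val2 (suc n) (suc n)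
... | a , o = a ∷ decodeF k (o / 2)

decode : ℕ → List ℕ
decode n = decodeF n n

restrict : (ℕ → ℕ) → ℕ → List ℕ
restrict f n = map f (upTo n)

_∈B_ : (ℕ → ℕ) → List ℕ → Set
f ∈B σ = restrict f (length σ) ≡ σ

data _≼_ : List ℕ → List ℕ → Set where
  []≼ : ∀ {τ} → [] ≼ τ
  ∷≼  : ∀ {a σ τ} → σ ≼ τ → (a ∷ σ) ≼ (a ∷ τ)

-- an open set, given by a listing of (codes of) strings
Listing : Set
Listing = ℕ → ℕ

_∈O_ : (ℕ → ℕ) → Listing → Set
f ∈O L = ∃ λ k → f ∈B decode (L k)

_⊆O_ : List ℕ → Listing → Set
τ ⊆O L = ∀ (f : ℕ → ℕ) → f ∈B τ → f ∈O L

Dense : Listing → Set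
Dense L = ∀ (σ : List ℕ) → ∃ λ τ → σ ≼ τ × τ ⊆O L

row : PR 2 → ℕ → Listing
row G n k = eval G (n ∷ k ∷ [])

-- Every primitive recursive function lies below some level ack m of the Ackermann function.
-- The n-th open set is B_[ n ] together with sets B_(σ ++ [ w ]) whose last entry w is large
-- compared to ack n (encode σ); the latter make it dense. A function f below ack n with f 0 < n
-- meets none of them: it avoids B_[ n ], and on B_(σ ++ [ w ]) it would take the value
-- f (length σ) = w > ack n (encode σ) ≥ ack n (length σ) > f (length σ). Taking n large for a
-- given primitive recursive f shows that f is not in the intersection. The listing is primitive
-- recursive uniformly in n because so is ack n x ⊓ b as a function of n, x and b: the values
-- ack n 0 ⊓ b, …, ack n b ⊓ b are the digits of a base-(1 + b) numeral computed by recursion on n.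

module Submission where

open import Defs
open import Data.Nat
open import Data.Nat.Properties
open import Data.Nat.DivMod
open import Data.Nat.Divisibility using (divides)
open import Data.Nat.Induction using (<-rec)
open import Data.Fin using (Fin; zero; suc; #_)
open import Data.Vec using (Vec; []; _∷_; lookup; head; tail)
open import Data.List using (List; []; _∷_; _++_; [_]; length; map; upTo; _∷ʳ_)
open import Data.List.Properties using (upTo-∷ʳ; map-++; ∷ʳ-injectiveʳ; ∷-injectiveˡ; length-++)
open import Data.Product using (Σ; ∃; _×_; _,_; proj₁; proj₂; map₁)
open import Data.Sum using (_⊎_; inj₁; inj₂)
open import Relation.Binary.PropositionalEquality hiding ([_])
open import Relation.Binary.Definitions using (tri<; tri≈; tri>)
open import Relation.Nullary using (¬_; yes; no; contradiction)

-- Ackermann's function dominates every primitive recursive function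

ack : ℕ → ℕ → ℕ
ack zero    x       = suc x
ack (suc m) zero    = ack m 1
ack (suc m) (suc x) = ack m (ack (suc m) x)

n<ack : ∀ m x → x < ack m x
n<ack zero    x       = ≤-refl
n<ack (suc m) zero    = <-trans z<s (n<ack m 1)
n<ack (suc m) (suc x) = <-≤-trans (s≤s (n<ack (suc m) x)) (n<ack m _)

ack<ack[1+x] : ∀ m x → ack m x < ack m (suc x)
ack<ack[1+x] zero    x = ≤-refl
ack<ack[1+x] (suc m) x = n<ack m (ack (suc m) x)

ack-monoʳ-< : ∀ m {x y} → x < y → ack m x < ack m y
ack-monoʳ-< m {x} {suc y} x<1+y with m≤n⇒m<n∨m≡n (≤-pred x<1+y)
... | inj₁ x<y  = <-trans (ack-monoʳ-< m x<y) (ack<ack[1+x] m y)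
... | inj₂ refl = ack<ack[1+x] m x

ack-monoʳ-≤ : ∀ m {x y} → x ≤ y → ack m x ≤ ack m y
ack-monoʳ-≤ m x≤y with m≤n⇒m<n∨m≡n x≤y
... | inj₁ x<y  = <⇒≤ (ack-monoʳ-< m x<y)
... | inj₂ refl = ≤-refl

ack[m,1+x]≤ack[1+m,x] : ∀ m x → ack m (suc x) ≤ ack (suc m) x
ack[m,1+x]≤ack[1+m,x] m zero    = ≤-refl
ack[m,1+x]≤ack[1+m,x] m (suc x) =
  ack-monoʳ-≤ m (≤-trans (n<ack m (suc x)) (ack[m,1+x]≤ack[1+m,x] m x))

ack<ack[1+m] : ∀ m x → ack m x < ack (suc m) x
ack<ack[1+m] m x = <-≤-trans (ack<ack[1+x] m x) (ack[m,1+x]≤ack[1+m,x] m x)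

ack-monoˡ-≤ : ∀ {m m′} x → m ≤ m′ → ack m x ≤ ack m′ x
ack-monoˡ-≤ x m≤m′ with m≤n⇒m<n∨m≡n m≤m′
... | inj₂ refl             = ≤-refl
... | inj₁ (s≤s {n = k} m≤k) = ≤-trans (ack-monoˡ-≤ x m≤k) (<⇒≤ (ack<ack[1+m] k x))

ack-∘-< : ∀ m₁ m₂ x → ack m₁ (ack m₂ x) < ack (2 + (m₁ ⊔ m₂)) x
ack-∘-< m₁ m₂ x = begin-strict
  ack m₁ (ack m₂ x)       ≤⟨ ack-monoˡ-≤ _ (m≤m⊔n m₁ m₂) ⟩
  ack m (ack m₂ x)        ≤⟨ ack-monoʳ-≤ m (ack-monoˡ-≤ x (m≤n⊔m m₁ m₂)) ⟩
  ack m (ack m x)         <⟨ ack-monoʳ-< m (ack<ack[1+m] m x) ⟩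
  ack (suc m) (suc x)     ≤⟨ ack[m,1+x]≤ack[1+m,x] (suc m) x ⟩
  ack (2 + m) x           ∎
  where m = m₁ ⊔ m₂
        open ≤-Reasoning

ack-2 : ∀ x → ack 2 x ≡ 3 + 2 * x
ack-2 zero    = refl
ack-2 (suc x) = begin
  ack 1 (ack 2 x)  ≡⟨ cong (ack 1) (ack-2 x) ⟩
  ack 1 (3 + 2 * x) ≡⟨ ack-1 (3 + 2 * x) ⟩
  5 + 2 * x        ≡⟨ cong (3 +_) (*-suc 2 x) ⟨
  3 + 2 * suc x    ∎
  where
  open ≡-Reasoning
  ack-1 : ∀ y → ack 1 y ≡ 2 + y
  ack-1 zero    = refl
  ack-1 (suc y) = cong suc (ack-1 y)

ack[x+x]< : ∀ m x → ack m (x + x) < ack (2 + (m ⊔ 2)) x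
ack[x+x]< m x = begin-strict
  ack m (x + x)       <⟨ ack-monoʳ-< m (s≤s (≤-trans x+x≤2x (m≤n+m _ 2))) ⟩
  ack m (3 + 2 * x)   ≡⟨ cong (ack m) (ack-2 x) ⟨
  ack m (ack 2 x)     <⟨ ack-∘-< m 2 x ⟩
  ack (2 + (m ⊔ 2)) x ∎
  where
  open ≤-Reasoning
  x+x≤2x : x + x ≤ 2 * x
  x+x≤2x = ≤-reflexive (cong (x +_) (sym (+-identityʳ x)))

maxᵛ : ∀ {n} → Vec ℕ n → ℕ
maxᵛ []       = 0
maxᵛ (x ∷ xs) = x ⊔ maxᵛ xs

lookup≤maxᵛ : ∀ {n} (xs : Vec ℕ n) i → lookup xs i ≤ maxᵛ xs
lookup≤maxᵛ (x ∷ xs) zero    = m≤m⊔n x _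
lookup≤maxᵛ (x ∷ xs) (suc i) = ≤-trans (lookup≤maxᵛ xs i) (m≤n⊔m x _)

AckDominated : ∀ {n} → PR n → Set
AckDominated {n} p = ∃ λ m → ∀ (xs : Vec ℕ n) → eval p xs < ack m (maxᵛ xs)

AckDominatedᵛ : ∀ {k n} → Vec (PR n) k → Set
AckDominatedᵛ {n = n} ps = ∃ λ m → ∀ (xs : Vec ℕ n) → maxᵛ (evalAll ps xs) < ack m (maxᵛ xs)

comp-ackDominated : ∀ {k n} {f : PR k} {gs : Vec (PR n) k} →
                    AckDominated f → AckDominatedᵛ gs → AckDominated (comp f gs)
comp-ackDominated (mf , hf) (mg , hg) = 2 + (mf ⊔ mg) , λ xs →
  <-trans (<-trans (hf _) (ack-monoʳ-< mf (hg xs))) (ack-∘-< mf mg (maxᵛ xs))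

prec-ackDominated : ∀ {n} {g : PR n} {h : PR (2 + n)} →
                    AckDominated g → AckDominated h → AckDominated (prec g h)
prec-ackDominated {g = g} {h} (mg , hg) (mh , hh) = 2 + (q ⊔ 2) , dominated
  where
  open ≤-Reasoning
  q : ℕ
  q = suc (mg ⊔ mh)
  bound : ∀ y xs → eval (prec g h) (y ∷ xs) < ack q (y + maxᵛ xs)
  bound zero    xs = <-≤-trans (hg xs) (ack-monoˡ-≤ _ (≤-trans (m≤m⊔n mg mh) (n≤1+n _)))
  bound (suc y) xs = begin-strict
    eval h (y ∷ r ∷ xs)      <⟨ hh _ ⟩
    ack mh (y ⊔ (r ⊔ maxᵛ xs)) <⟨ ack-monoʳ-< mh args<z ⟩
    ack mh z                 ≤⟨ ack-monoˡ-≤ z (m≤n⊔m mg mh) ⟩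
    ack (mg ⊔ mh) z          ∎
    where
    r z : ℕ
    r = eval (prec g h) (y ∷ xs)
    z = ack q (y + maxᵛ xs)
    args<z : y ⊔ (r ⊔ maxᵛ xs) < z
    args<z = ⊔-lub (≤-<-trans (m≤m+n y _) (n<ack q _))
                   (⊔-lub (bound y xs) (≤-<-trans (m≤n+m _ y) (n<ack q _)))
  dominated : ∀ xs → eval (prec g h) xs < ack (2 + (q ⊔ 2)) (maxᵛ xs)
  dominated (y ∷ xs) = begin-strict
    eval (prec g h) (y ∷ xs) <⟨ bound y xs ⟩
    ack q (y + maxᵛ xs)      ≤⟨ ack-monoʳ-≤ q (+-mono-≤ (m≤m⊔n y _) (m≤n⊔m y _)) ⟩
    ack q (z + z)            <⟨ ack[x+x]< q z ⟩
    ack (2 + (q ⊔ 2)) z      ∎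
    where
    z : ℕ
    z = y ⊔ maxᵛ xs

mutual
  ack-dominates : ∀ {n} (p : PR n) → AckDominated p
  ack-dominates zeroF       = 0 , λ _ → z<s
  ack-dominates succF       = 1 , λ where
    (x ∷ []) → ≤-trans (s≤s (s≤s (≤-reflexive (sym (⊔-identityʳ x))))) (ack[m,1+x]≤ack[1+m,x] 0 (x ⊔ 0))
  ack-dominates (proj i)    = 0 , λ xs → s≤s (lookup≤maxᵛ xs i)
  ack-dominates (comp f gs) = comp-ackDominated {f = f} {gs} (ack-dominates f) (ack-dominatesᵛ gs)
  ack-dominates (prec g h)  = prec-ackDominated (ack-dominates g) (ack-dominates h)

  ack-dominatesᵛ : ∀ {k n} (ps : Vec (PR n) k) → AckDominatedᵛ ps
  ack-dominatesᵛ []       = 0 , λ _ → z<s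
  ack-dominatesᵛ (p ∷ ps) with ack-dominates p | ack-dominatesᵛ ps
  ... | m₁ , h₁ | m₂ , h₂ = m₁ ⊔ m₂ , λ xs →
    ⊔-lub (<-≤-trans (h₁ xs) (ack-monoˡ-≤ _ (m≤m⊔n m₁ m₂)))
          (<-≤-trans (h₂ xs) (ack-monoˡ-≤ _ (m≤n⊔m m₁ m₂)))

primRec<ack : ∀ {f} → IsPrimRec f → ∃ λ m → ∀ x → f x < ack m x
primRec<ack {f} (p , p≡f) with ack-dominates p
... | m , p<ack = m , λ x → subst₂ _<_ (p≡f x) (cong (ack m) (⊔-identityʳ x)) (p<ack (x ∷ []))

-- Primitive recursive functions on vectors

IsPrimRecᵛ : ∀ n → (Vec ℕ n → ℕ) → Set
IsPrimRecᵛ n F = Σ (PR n) λ p → ∀ xs → eval p xs ≡ F xs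

unary : (ℕ → ℕ) → Vec ℕ 1 → ℕ
unary f (x ∷ []) = f x

binary : (ℕ → ℕ → ℕ) → Vec ℕ 2 → ℕ
binary f (x ∷ y ∷ []) = f x y

ternary : (ℕ → ℕ → ℕ → ℕ) → Vec ℕ 3 → ℕ
ternary f (x ∷ y ∷ z ∷ []) = f x y z

module _ {n : ℕ} where

  respᴾ : ∀ {F G} → F ≗ G → IsPrimRecᵛ n F → IsPrimRecᵛ n G
  respᴾ F≗G (p , p≡F) = p , λ xs → trans (p≡F xs) (F≗G xs)

  zeroᴾ : IsPrimRecᵛ n (λ _ → 0)
  zeroᴾ = zeroF , λ _ → refl

  varᴾ : (i : Fin n) → IsPrimRecᵛ n (λ xs → lookup xs i)
  varᴾ i = proj i , λ _ → refl

  sucᴾ : ∀ {F} → IsPrimRecᵛ n F → IsPrimRecᵛ n (λ xs → suc (F xs))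
  sucᴾ (p , p≡F) = comp succF (p ∷ []) , λ xs → cong suc (p≡F xs)

  constᴾ : ∀ k → IsPrimRecᵛ n (λ _ → k)
  constᴾ zero    = zeroᴾ
  constᴾ (suc k) = sucᴾ (constᴾ k)

  compᴾ₁ : ∀ {F G} → IsPrimRecᵛ 1 F → IsPrimRecᵛ n G → IsPrimRecᵛ n (λ xs → F (G xs ∷ []))
  compᴾ₁ {F} (p , p≡F) (q , q≡G) = comp p (q ∷ []) , λ xs →
    trans (p≡F _) (cong (λ a → F (a ∷ [])) (q≡G xs))

  compᴾ₂ : ∀ {F G₁ G₂} → IsPrimRecᵛ 2 F → IsPrimRecᵛ n G₁ → IsPrimRecᵛ n G₂ →
           IsPrimRecᵛ n (λ xs → F (G₁ xs ∷ G₂ xs ∷ []))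
  compᴾ₂ {F} (p , p≡F) (q₁ , q₁≡G₁) (q₂ , q₂≡G₂) = comp p (q₁ ∷ q₂ ∷ []) , λ xs →
    trans (p≡F _) (cong₂ (λ a b → F (a ∷ b ∷ [])) (q₁≡G₁ xs) (q₂≡G₂ xs))

  compᴾ₃ : ∀ {F G₁ G₂ G₃} → IsPrimRecᵛ 3 F →
           IsPrimRecᵛ n G₁ → IsPrimRecᵛ n G₂ → IsPrimRecᵛ n G₃ →
           IsPrimRecᵛ n (λ xs → F (G₁ xs ∷ G₂ xs ∷ G₃ xs ∷ []))
  compᴾ₃ {F} (p , p≡F) (q₁ , q₁≡G₁) (q₂ , q₂≡G₂) (q₃ , q₃≡G₃) =
    comp p (q₁ ∷ q₂ ∷ q₃ ∷ []) , λ xs → trans (p≡F _)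
      (trans (cong₂ (λ a b → F (a ∷ b ∷ _ ∷ [])) (q₁≡G₁ xs) (q₂≡G₂ xs))
             (cong (λ c → F (_ ∷ _ ∷ c ∷ [])) (q₃≡G₃ xs)))

recursion : ∀ {n} → (Vec ℕ n → ℕ) → (Vec ℕ (2 + n) → ℕ) → ℕ → Vec ℕ n → ℕ
recursion G H zero    xs = G xs
recursion G H (suc y) xs = H (y ∷ recursion G H y xs ∷ xs)

recᴾ : ∀ {n G H} → IsPrimRecᵛ n G → IsPrimRecᵛ (2 + n) H →
       IsPrimRecᵛ (suc n) (λ v → recursion G H (head v) (tail v))
recᴾ {n} {G} {H} (g , g≡G) (h , h≡H) = prec g h , λ where (y ∷ xs) → computes y xs
  where
  computes : ∀ y xs → eval (prec g h) (y ∷ xs) ≡ recursion G H y xs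
  computes zero    xs = g≡G xs
  computes (suc y) xs = trans (h≡H _) (cong (λ r → H (y ∷ r ∷ xs)) (computes y xs))

ifZero : ℕ → ℕ → ℕ → ℕ
ifZero zero    a b = a
ifZero (suc _) a b = b

ifZeroᴾ : IsPrimRecᵛ 3 (ternary ifZero)
ifZeroᴾ = respᴾ (λ where (zero ∷ a ∷ b ∷ []) → refl
                         (suc c ∷ a ∷ b ∷ []) → refl)
                (recᴾ (varᴾ (# 0)) (varᴾ (# 3)))

addᴾ : IsPrimRecᵛ 2 (binary _+_)
addᴾ = respᴾ (λ where (x ∷ y ∷ []) → computes x y) (recᴾ (varᴾ (# 0)) (sucᴾ (varᴾ (# 1))))
  where
  computes : ∀ x y → recursion _ _ x (y ∷ []) ≡ x + y
  computes zero    y = refl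
  computes (suc x) y = cong suc (computes x y)

mulᴾ : IsPrimRecᵛ 2 (binary _*_)
mulᴾ = respᴾ (λ where (x ∷ y ∷ []) → computes x y)
             (recᴾ zeroᴾ (compᴾ₂ addᴾ (varᴾ (# 2)) (varᴾ (# 1))))
  where
  computes : ∀ x y → recursion _ _ x (y ∷ []) ≡ x * y
  computes zero    y = refl
  computes (suc x) y = cong (y +_) (computes x y)

predᴾ : IsPrimRecᵛ 1 (unary pred)
predᴾ = respᴾ (λ where (zero ∷ []) → refl
                       (suc x ∷ []) → refl)
              (recᴾ zeroᴾ (varᴾ (# 0)))

monusᴾ : IsPrimRecᵛ 2 (binary _∸_)
monusᴾ = respᴾ (λ where (x ∷ y ∷ []) → refl) (compᴾ₂ flippedMonusᴾ (varᴾ (# 1)) (varᴾ (# 0)))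
  where
  computes : ∀ y x → recursion _ _ y (x ∷ []) ≡ x ∸ y
  computes zero    x = refl
  computes (suc y) x = trans (cong pred (computes y x)) (pred[m∸n]≡m∸[1+n] x y)
  flippedMonusᴾ : IsPrimRecᵛ 2 (binary (λ y x → x ∸ y))
  flippedMonusᴾ = respᴾ (λ where (y ∷ x ∷ []) → computes y x)
                        (recᴾ (varᴾ (# 0)) (compᴾ₁ predᴾ (varᴾ (# 1))))

minᴾ : IsPrimRecᵛ 2 (binary _⊓_)
minᴾ = respᴾ (λ where (x ∷ y ∷ []) → x∸[x∸y]≡x⊓y x y)
             (compᴾ₂ monusᴾ (varᴾ (# 0)) (compᴾ₂ monusᴾ (varᴾ (# 0)) (varᴾ (# 1))))
  where
  x∸[x∸y]≡x⊓y : ∀ x y → x ∸ (x ∸ y) ≡ x ⊓ y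
  x∸[x∸y]≡x⊓y x y = begin
    x ∸ (x ∸ y)               ≡⟨ cong (_∸ (x ∸ y)) (m⊓n+n∸m≡n y x) ⟨
    y ⊓ x + (x ∸ y) ∸ (x ∸ y) ≡⟨ m+n∸n≡m (y ⊓ x) (x ∸ y) ⟩
    y ⊓ x                     ≡⟨ ⊓-comm y x ⟩
    x ⊓ y                     ∎
    where open ≡-Reasoning

pow2ᴾ : IsPrimRecᵛ 1 (unary (2 ^_))
pow2ᴾ = respᴾ (λ where (e ∷ []) → computes e)
              (recᴾ (constᴾ 1) (compᴾ₂ mulᴾ (constᴾ 2) (varᴾ (# 1))))
  where
  computes : ∀ e → recursion _ _ e [] ≡ 2 ^ e
  computes zero    = refl
  computes (suc e) = cong (2 *_) (computes e)

-- Truncated Ackermann function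

remainder : ℕ → ℕ → ℕ
remainder zero    b = 0
remainder (suc w) b = ifZero (b ∸ remainder w b) 0 (suc (remainder w b))

quotient : ℕ → ℕ → ℕ
quotient zero    b = 0
quotient (suc w) b = ifZero (b ∸ remainder w b) (suc (quotient w b)) (quotient w b)

remainder≤ : ∀ w b → remainder w b ≤ b
remainder≤ zero    b = z≤n
remainder≤ (suc w) b with b ∸ remainder w b in eq
... | zero  = z≤n
... | suc _ = m∸n≢0⇒n<m λ eq′ → 0≢1+n (trans (sym eq′) eq)

division-remainder-quotient : ∀ w b → w ≡ remainder w b + quotient w b * suc b
division-remainder-quotient zero    b = refl
division-remainder-quotient (suc w) b with b ∸ remainder w b in eq
... | zero  = cong suc (trans (division-remainder-quotient w b) (cong (_+ quotient w b * suc b) r≡b))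
  where
  r≡b : remainder w b ≡ b
  r≡b = ≤-antisym (remainder≤ w b) (m∸n≡0⇒m≤n eq)
... | suc _ = cong suc (division-remainder-quotient w b)

[d+X*[1+b]]%[1+b]≡d : ∀ {d b} X → d ≤ b → (d + X * suc b) % suc b ≡ d
[d+X*[1+b]]%[1+b]≡d {d} {b} X d≤b = trans ([m+kn]%n≡m%n d X (suc b)) (m<n⇒m%n≡m (s≤s d≤b))

[d+X*[1+b]]/[1+b]≡X : ∀ {d b} X → d ≤ b → (d + X * suc b) / suc b ≡ X
[d+X*[1+b]]/[1+b]≡X {d} {b} X d≤b = trans (+-distrib-/-∣ʳ d (divides X refl))
  (cong₂ _+_ (m<n⇒m/n≡0 (s≤s d≤b)) (m*n/n≡m X (suc b)))

remainder≡% : ∀ w b → remainder w b ≡ w % suc b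
remainder≡% w b = sym (trans (cong (_% suc b) (division-remainder-quotient w b))
                             ([d+X*[1+b]]%[1+b]≡d (quotient w b) (remainder≤ w b)))

quotient≡/ : ∀ w b → quotient w b ≡ w / suc b
quotient≡/ w b = sym (trans (cong (_/ suc b) (division-remainder-quotient w b))
                            ([d+X*[1+b]]/[1+b]≡X (quotient w b) (remainder≤ w b)))

remainderᴾ : IsPrimRecᵛ 2 (binary remainder)
remainderᴾ = respᴾ (λ where (w ∷ b ∷ []) → computes w b)
  (recᴾ zeroᴾ (compᴾ₃ ifZeroᴾ (compᴾ₂ monusᴾ (varᴾ (# 2)) (varᴾ (# 1))) zeroᴾ (sucᴾ (varᴾ (# 1)))))
  where
  computes : ∀ w b → recursion _ _ w (b ∷ []) ≡ remainder w b
  computes zero    b = refl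
  computes (suc w) b = cong (λ r → ifZero (b ∸ r) 0 (suc r)) (computes w b)

quotientᴾ : IsPrimRecᵛ 2 (binary quotient)
quotientᴾ = respᴾ (λ where (w ∷ b ∷ []) → computes w b)
  (recᴾ zeroᴾ (compᴾ₃ ifZeroᴾ (compᴾ₂ monusᴾ (varᴾ (# 2)) (compᴾ₂ remainderᴾ (varᴾ (# 0)) (varᴾ (# 2))))
                              (sucᴾ (varᴾ (# 1))) (varᴾ (# 1))))
  where
  computes : ∀ w b → recursion _ _ w (b ∷ []) ≡ quotient w b
  computes zero    b = refl
  computes (suc w) b = cong (λ q → ifZero (b ∸ remainder w b) (suc q) q) (computes w b)

%[1+b]ᴾ : IsPrimRecᵛ 2 (binary λ w b → w % suc b)
%[1+b]ᴾ = respᴾ (λ where (w ∷ b ∷ []) → remainder≡% w b) remainderᴾ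

/[1+b]ᴾ : IsPrimRecᵛ 2 (binary λ w b → w / suc b)
/[1+b]ᴾ = respᴾ (λ where (w ∷ b ∷ []) → quotient≡/ w b) quotientᴾ

shift : ℕ → ℕ → ℕ → ℕ
shift zero    W b = W
shift (suc u) W b = shift u W b / suc b

digit : ℕ → ℕ → ℕ → ℕ
digit W b u = shift u W b % suc b

shift-suc : ∀ u W b → shift (suc u) W b ≡ shift u (W / suc b) b
shift-suc zero    W b = refl
shift-suc (suc u) W b = cong (_/ suc b) (shift-suc u W b)

numeral : (ℕ → ℕ) → ℕ → ℕ → ℕ → ℕ
numeral e b s zero    = 0
numeral e b s (suc l) = e s + numeral e b (suc s) l * suc b

digit-numeral : ∀ {e b} → (∀ i → e i ≤ b) → ∀ s {u l} → u < l → digit (numeral e b s l) b u ≡ e (s + u)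
digit-numeral {e} {b} e≤b s {zero}  {suc l} _ =
  trans ([d+X*[1+b]]%[1+b]≡d (numeral e b (suc s) l) (e≤b s)) (cong e (sym (+-identityʳ s)))
digit-numeral {e} {b} e≤b s {suc u} {suc l} (s≤s u<l) = begin
  shift (suc u) (numeral e b s (suc l)) b % suc b       ≡⟨ cong (_% suc b) (shift-suc u _ b) ⟩
  digit (numeral e b s (suc l) / suc b) b u             ≡⟨ cong (λ W → digit W b u) ([d+X*[1+b]]/[1+b]≡X (numeral e b (suc s) l) (e≤b s)) ⟩
  digit (numeral e b (suc s) l) b u                     ≡⟨ digit-numeral e≤b (suc s) u<l ⟩
  e (suc s + u)                                         ≡⟨ cong e (+-suc s u) ⟨
  e (s + suc u)                                         ∎
  where open ≡-Reasoning

-- Horner's scheme for numeral e b 0 (1 + b): the recursion on j keeps the parameters fixed, as prec requires.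
horner : (ℕ → ℕ) → ℕ → ℕ → ℕ
horner e b zero    = 0
horner e b (suc j) = e (b ∸ j) + horner e b j * suc b

horner≡numeral : ∀ e b {j} → j ≤ suc b → horner e b j ≡ numeral e b (suc b ∸ j) j
horner≡numeral e b {zero}  _         = refl
horner≡numeral e b {suc j} (s≤s j≤b) = cong (e (b ∸ j) +_) (cong (_* suc b)
  (trans (horner≡numeral e b (m≤n⇒m≤1+n j≤b)) (cong (λ s → numeral e b s j) (+-∸-assoc 1 j≤b))))

digit-horner : ∀ {e b u} → (∀ i → e i ≤ b) → u ≤ b → digit (horner e b (suc b)) b u ≡ e u
digit-horner {e} {b} {u} e≤b u≤b = begin
  digit (horner e b (suc b)) b u                ≡⟨ cong (λ W → digit W b u) (horner≡numeral e b ≤-refl) ⟩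
  digit (numeral e b (suc b ∸ suc b) (suc b)) b u ≡⟨ cong (λ s → digit (numeral e b s (suc b)) b u) (n∸n≡0 b) ⟩
  digit (numeral e b 0 (suc b)) b u             ≡⟨ digit-numeral e≤b 0 (s≤s u≤b) ⟩
  e u                                           ∎
  where open ≡-Reasoning

-- If the digits of W are g 0 ⊓ b, …, g b ⊓ b, then tableIter j W b ≡ g (g (… (g 1))) ⊓ b with j applications of g.
tableIter : ℕ → ℕ → ℕ → ℕ
tableIter zero    W b = 1 ⊓ b
tableIter (suc j) W b = digit W b (tableIter j W b)

tableIter≤ : ∀ j W b → tableIter j W b ≤ b
tableIter≤ zero    W b = m⊓n≤n 1 b
tableIter≤ (suc j) W b = ≤-pred (m%n<n (shift (tableIter j W b) W b) (suc b))

ackTable : ℕ → ℕ → ℕ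
ackTable zero    b = horner (λ u → suc u ⊓ b) b (suc b)
ackTable (suc n) b = horner (λ u → tableIter (suc u) (ackTable n b) b) b (suc b)

-- Holds because ack n is increasing and above the identity.
ack[x⊓b]⊓b≡ack[x]⊓b : ∀ n x b → ack n (x ⊓ b) ⊓ b ≡ ack n x ⊓ b
ack[x⊓b]⊓b≡ack[x]⊓b n x b with ≤-total x b
... | inj₁ x≤b = cong (λ t → ack n t ⊓ b) (m≤n⇒m⊓n≡m x≤b)
... | inj₂ b≤x = begin
  ack n (x ⊓ b) ⊓ b ≡⟨ cong (λ t → ack n t ⊓ b) (m≥n⇒m⊓n≡n b≤x) ⟩
  ack n b ⊓ b       ≡⟨ m≥n⇒m⊓n≡n (<⇒≤ (n<ack n b)) ⟩
  b                 ≡⟨ m≥n⇒m⊓n≡n (≤-trans b≤x (<⇒≤ (n<ack n x))) ⟨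
  ack n x ⊓ b       ∎
  where open ≡-Reasoning

digit-ackTable : ∀ n b {u} → u ≤ b → digit (ackTable n b) b u ≡ ack n u ⊓ b
digit-ackTable zero    b u≤b = digit-horner (λ i → m⊓n≤n _ b) u≤b
digit-ackTable (suc n) b {u} u≤b =
  trans (digit-horner (λ i → tableIter≤ (suc i) _ b) u≤b) (tableIter≡ack u)
  where
  tableIter≡ack : ∀ j → tableIter (suc j) (ackTable n b) b ≡ ack (suc n) j ⊓ b
  tableIter≡ack zero    = trans (digit-ackTable n b (m⊓n≤n 1 b)) (ack[x⊓b]⊓b≡ack[x]⊓b n 1 b)
  tableIter≡ack (suc j) = begin
    digit (ackTable n b) b (tableIter (suc j) (ackTable n b) b) ≡⟨ digit-ackTable n b (tableIter≤ (suc j) _ b) ⟩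
    ack n (tableIter (suc j) (ackTable n b) b) ⊓ b             ≡⟨ cong (λ t → ack n t ⊓ b) (tableIter≡ack j) ⟩
    ack n (ack (suc n) j ⊓ b) ⊓ b                             ≡⟨ ack[x⊓b]⊓b≡ack[x]⊓b n _ b ⟩
    ack (suc n) (suc j) ⊓ b                                   ∎
    where open ≡-Reasoning

digit-ackTable-⊓ : ∀ n x b → digit (ackTable n b) b (x ⊓ b) ≡ ack n x ⊓ b
digit-ackTable-⊓ n x b = trans (digit-ackTable n b (m⊓n≤n x b)) (ack[x⊓b]⊓b≡ack[x]⊓b n x b)

shiftᴾ : IsPrimRecᵛ 3 (ternary shift)
shiftᴾ = respᴾ (λ where (u ∷ W ∷ b ∷ []) → computes u W b)
  (recᴾ (varᴾ (# 0)) (compᴾ₂ /[1+b]ᴾ (varᴾ (# 1)) (varᴾ (# 3))))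
  where
  computes : ∀ u W b → recursion _ _ u (W ∷ b ∷ []) ≡ shift u W b
  computes zero    W b = refl
  computes (suc u) W b = cong (_/ suc b) (computes u W b)

digitᴾ : IsPrimRecᵛ 3 (ternary digit)
digitᴾ = respᴾ (λ where (W ∷ b ∷ u ∷ []) → refl)
  (compᴾ₂ %[1+b]ᴾ (compᴾ₃ shiftᴾ (varᴾ (# 2)) (varᴾ (# 0)) (varᴾ (# 1))) (varᴾ (# 1)))

hornerᴾ : ∀ {e} → IsPrimRecᵛ 3 (ternary e) →
          IsPrimRecᵛ 3 (ternary λ j W b → horner (λ u → e u W b) b j)
hornerᴾ {e} eᴾ = respᴾ (λ where (j ∷ W ∷ b ∷ []) → computes j W b)
  (recᴾ zeroᴾ (compᴾ₂ addᴾ (compᴾ₃ eᴾ (compᴾ₂ monusᴾ (varᴾ (# 3)) (varᴾ (# 0))) (varᴾ (# 2)) (varᴾ (# 3)))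
                           (compᴾ₂ mulᴾ (varᴾ (# 1)) (sucᴾ (varᴾ (# 3))))))
  where
  computes : ∀ j W b → recursion _ _ j (W ∷ b ∷ []) ≡ horner (λ u → e u W b) b j
  computes zero    W b = refl
  computes (suc j) W b = cong (λ r → e (b ∸ j) W b + r * suc b) (computes j W b)

tableIterᴾ : IsPrimRecᵛ 3 (ternary tableIter)
tableIterᴾ = respᴾ (λ where (j ∷ W ∷ b ∷ []) → computes j W b)
  (recᴾ (compᴾ₂ minᴾ (constᴾ 1) (varᴾ (# 1))) (compᴾ₃ digitᴾ (varᴾ (# 2)) (varᴾ (# 3)) (varᴾ (# 1))))
  where
  computes : ∀ j W b → recursion _ _ j (W ∷ b ∷ []) ≡ tableIter j W b
  computes zero    W b = refl
  computes (suc j) W b = cong (digit W b) (computes j W b)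

ackTableᴾ : IsPrimRecᵛ 2 (binary ackTable)
ackTableᴾ = respᴾ (λ where (n ∷ b ∷ []) → computes n b)
  (recᴾ (compᴾ₃ (hornerᴾ firstRowᴾ) (sucᴾ (varᴾ (# 0))) zeroᴾ (varᴾ (# 0)))
        (compᴾ₃ (hornerᴾ nextRowᴾ) (sucᴾ (varᴾ (# 2))) (varᴾ (# 1)) (varᴾ (# 2))))
  where
  firstRowᴾ : IsPrimRecᵛ 3 (ternary λ u W b → suc u ⊓ b)
  firstRowᴾ = respᴾ (λ where (u ∷ W ∷ b ∷ []) → refl) (compᴾ₂ minᴾ (sucᴾ (varᴾ (# 0))) (varᴾ (# 2)))
  nextRowᴾ : IsPrimRecᵛ 3 (ternary λ u W b → tableIter (suc u) W b)
  nextRowᴾ = respᴾ (λ where (u ∷ W ∷ b ∷ []) → refl)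
    (compᴾ₃ tableIterᴾ (sucᴾ (varᴾ (# 0))) (varᴾ (# 1)) (varᴾ (# 2)))
  computes : ∀ n b → recursion _ _ n (b ∷ []) ≡ ackTable n b
  computes zero    b = refl
  computes (suc n) b = cong (λ W → horner (λ u → tableIter (suc u) W b) b (suc b)) (computes n b)

ack⊓ᴾ : IsPrimRecᵛ 3 (ternary λ n x b → ack n x ⊓ b)
ack⊓ᴾ = respᴾ (λ where (n ∷ x ∷ b ∷ []) → digit-ackTable-⊓ n x b)
  (compᴾ₃ digitᴾ (compᴾ₂ ackTableᴾ (varᴾ (# 0)) (varᴾ (# 2))) (varᴾ (# 2)) (compᴾ₂ minᴾ (varᴾ (# 1)) (varᴾ (# 2))))

-- Codes of strings

encode : List ℕ → ℕ
encode []      = 0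
encode (a ∷ σ) = 2 ^ a * suc (2 * encode σ)

[1+2e]%2≡1 : ∀ e → suc (2 * e) % 2 ≡ 1
[1+2e]%2≡1 e = trans (cong (λ t → suc t % 2) (*-comm 2 e)) ([m+kn]%n≡m%n 1 e 2)

[1+2e]/2≡e : ∀ e → suc (2 * e) / 2 ≡ e
[1+2e]/2≡e e = begin
  suc (2 * e) / 2   ≡⟨ cong (λ t → suc t / 2) (*-comm 2 e) ⟩
  (1 + e * 2) / 2   ≡⟨ +-distrib-/-∣ʳ 1 {d = 2} (divides e refl) ⟩
  0 + e * 2 / 2     ≡⟨ m*n/n≡m e 2 ⟩
  e                 ∎
  where open ≡-Reasoning

val2-odd : ∀ k e → val2 (suc k) (suc (2 * e)) ≡ (0 , suc (2 * e))
val2-odd k e rewrite [1+2e]%2≡1 e = refl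

[2x]%2≡0 : ∀ x → 2 * x % 2 ≡ 0
[2x]%2≡0 x = trans (cong (_% 2) (*-comm 2 x)) (m*n%n≡0 x 2)

[2x]/2≡x : ∀ x → 2 * x / 2 ≡ x
[2x]/2≡x x = trans (cong (_/ 2) (*-comm 2 x)) (m*n/n≡m x 2)

val2-double : ∀ k {x} → 0 < x → val2 (suc k) (2 * x) ≡ map₁ suc (val2 k x)
val2-double k {suc x} _ rewrite [2x]%2≡0 (suc x) | [2x]/2≡x (suc x) with val2 k (suc x)
... | a , o = refl

n≤2^a*n : ∀ a n → n ≤ 2 ^ a * n
n≤2^a*n a n = subst (_≤ 2 ^ a * n) (*-identityˡ n) (*-monoˡ-≤ n (m^n>0 2 a))

e<2^a*[1+2e] : ∀ a e → e < 2 ^ a * suc (2 * e)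
e<2^a*[1+2e] a e = <-≤-trans (s≤s (m≤m+n e (e + 0))) (n≤2^a*n a _)

2^a*[1+2e]>0 : ∀ a e → 0 < 2 ^ a * suc (2 * e)
2^a*[1+2e]>0 a e = ≤-<-trans z≤n (e<2^a*[1+2e] a e)

val2-2^a*[1+2e] : ∀ {k} a e → 2 ^ a * suc (2 * e) ≤ k → val2 k (2 ^ a * suc (2 * e)) ≡ (a , suc (2 * e))
val2-2^a*[1+2e] {zero}  a       e le = contradiction le (<⇒≱ (2^a*[1+2e]>0 a e))
val2-2^a*[1+2e] {suc k} zero    e le =
  subst (λ N → val2 (suc k) N ≡ (0 , suc (2 * e))) (sym (*-identityˡ _)) (val2-odd k e)
val2-2^a*[1+2e] {suc k} (suc a) e le rewrite *-assoc 2 (2 ^ a) (suc (2 * e)) =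
  trans (val2-double k (2^a*[1+2e]>0 a e)) (cong (map₁ suc) (val2-2^a*[1+2e] a e x≤k))
  where
  x : ℕ
  x = 2 ^ a * suc (2 * e)
  x≤k : x ≤ k
  x≤k = ≤-pred (begin-strict
    x       <⟨ m<m+n x (2^a*[1+2e]>0 a e) ⟩
    x + x   ≡⟨ cong (x +_) (+-identityʳ x) ⟨
    2 * x   ≤⟨ le ⟩
    suc k   ∎)
    where open ≤-Reasoning

decodeF-cons : ∀ k a e → decodeF (suc k) (2 ^ a * suc (2 * e)) ≡ a ∷ decodeF k e
decodeF-cons k a e with 2 ^ a * suc (2 * e) | val2-2^a*[1+2e] a e ≤-refl | 2^a*[1+2e]>0 a e
... | suc n | val2≡ | _ rewrite val2≡ = cong (λ c → a ∷ decodeF k c) ([1+2e]/2≡e e)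

decodeF-encode : ∀ {k} σ → encode σ ≤ k → decodeF k (encode σ) ≡ σ
decodeF-encode {zero}  []      _  = refl
decodeF-encode {suc k} []      _  = refl
decodeF-encode {zero}  (a ∷ σ) le = contradiction le (<⇒≱ (2^a*[1+2e]>0 a (encode σ)))
decodeF-encode {suc k} (a ∷ σ) le = trans (decodeF-cons k a (encode σ))
  (cong (a ∷_) (decodeF-encode σ (≤-pred (<-≤-trans (e<2^a*[1+2e] a (encode σ)) le))))

decode-encode : ∀ σ → decode (encode σ) ≡ σ
decode-encode σ = decodeF-encode σ ≤-refl

decode-2^ : ∀ n → decode (2 ^ n) ≡ [ n ]
decode-2^ n = trans (cong decode (sym (*-identityʳ (2 ^ n)))) (decode-encode [ n ])

even⊎odd : ∀ n → ∃ λ k → n ≡ 2 * k ⊎ n ≡ suc (2 * k)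
even⊎odd zero = 0 , inj₁ refl
even⊎odd (suc n) with even⊎odd n
... | k , inj₁ n≡2k   = k , inj₂ (cong suc n≡2k)
... | k , inj₂ n≡1+2k = suc k , inj₁ (trans (cong suc n≡1+2k) (sym (*-suc 2 k)))

encode-surjective : ∀ c → ∃ λ σ → encode σ ≡ c
encode-surjective = <-rec _ surj
  where
  surj : ∀ c → (∀ {c′} → c′ < c → ∃ λ σ → encode σ ≡ c′) → ∃ λ σ → encode σ ≡ c
  surj zero    _   = [] , refl
  surj (suc c) rec with even⊎odd (suc c)
  ... | k , inj₂ 1+c≡1+2k with rec (s≤s (≤-trans (m≤m+n k (k + 0)) (≤-reflexive (suc-injective (sym 1+c≡1+2k)))))
  ...   | σ , σ↦k = 0 ∷ σ , trans (*-identityˡ _) (trans (cong (λ t → suc (2 * t)) σ↦k) (sym 1+c≡1+2k))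
  surj (suc c) rec | suc k , inj₁ 1+c≡2k with rec (<-≤-trans (m<m+n (suc k) z<s) (≤-reflexive (sym 1+c≡2k)))
  ...   | [] , ()
  ...   | a ∷ σ , σ↦k = suc a ∷ σ , trans (*-assoc 2 (2 ^ a) _) (trans (cong (2 *_) σ↦k) (sym 1+c≡2k))

width : List ℕ → ℕ
width []      = 0
width (a ∷ σ) = a + suc (width σ)

encode<2^width : ∀ σ → encode σ < 2 ^ width σ
encode<2^width []      = s≤s z≤n
encode<2^width (a ∷ σ) = begin-strict
  2 ^ a * suc (2 * encode σ) <⟨ *-monoʳ-< (2 ^ a) {{>-nonZero (m^n>0 2 a)}} 1+2e<2*2^w ⟩
  2 ^ a * (2 * 2 ^ width σ)  ≡⟨ ^-distribˡ-+-* 2 a (suc (width σ)) ⟨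
  2 ^ (a + suc (width σ))    ∎
  where
  open ≤-Reasoning
  1+2e<2*2^w : suc (2 * encode σ) < 2 * 2 ^ width σ
  1+2e<2*2^w = <-≤-trans (n<1+n _) (≤-trans (≤-reflexive (sym (*-suc 2 (encode σ))))
                                            (*-monoʳ-≤ 2 (encode<2^width σ)))

n<2^n : ∀ n → n < 2 ^ n
n<2^n zero    = s≤s z≤n
n<2^n (suc n) = +-mono-≤-< (m^n>0 2 n) (≤-trans (n<2^n n) (≤-reflexive (sym (+-identityʳ _))))

width≤encode : ∀ σ → width σ ≤ encode σ
width≤encode []      = z≤n
width≤encode (a ∷ σ) = begin
  a + suc (width σ)      ≡⟨ +-suc a (width σ) ⟩
  suc a + width σ        ≤⟨ +-mono-≤ (n<2^n a) (≤-trans (width≤encode σ) (m≤m+n e (e + 0))) ⟩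
  2 ^ a + 2 * e          ≤⟨ +-monoʳ-≤ (2 ^ a) (n≤2^a*n a (2 * e)) ⟩
  2 ^ a + 2 ^ a * (2 * e) ≡⟨ *-suc (2 ^ a) (2 * e) ⟨
  2 ^ a * suc (2 * e)    ∎
  where
  open ≤-Reasoning
  e : ℕ
  e = encode σ

length≤width : ∀ σ → length σ ≤ width σ
length≤width []      = z≤n
length≤width (a ∷ σ) = ≤-trans (s≤s (length≤width σ)) (m≤n+m _ a)

encode-∷ʳ : ∀ σ w → encode (σ ++ [ w ]) ≡ encode σ + 2 ^ (width σ + w)
encode-∷ʳ []      w = *-identityʳ (2 ^ w)
encode-∷ʳ (a ∷ σ) w = begin
  2 ^ a * suc (2 * encode (σ ++ [ w ]))           ≡⟨ cong (λ t → 2 ^ a * suc (2 * t)) (encode-∷ʳ σ w) ⟩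
  2 ^ a * suc (2 * (e + P))                      ≡⟨ cong (λ t → 2 ^ a * suc t) (*-distribˡ-+ 2 e P) ⟩
  2 ^ a * (suc (2 * e) + 2 * P)                  ≡⟨ *-distribˡ-+ (2 ^ a) (suc (2 * e)) (2 * P) ⟩
  2 ^ a * suc (2 * e) + 2 ^ a * (2 * P)          ≡⟨ cong (2 ^ a * suc (2 * e) +_) (^-distribˡ-+-* 2 a (suc (width σ + w))) ⟨
  2 ^ a * suc (2 * e) + 2 ^ (a + suc (width σ + w)) ≡⟨ cong (λ t → 2 ^ a * suc (2 * e) + 2 ^ t) (+-assoc a (suc (width σ)) w) ⟨
  2 ^ a * suc (2 * e) + 2 ^ (a + suc (width σ) + w) ∎
  where
  open ≡-Reasoning
  e P : ℕ
  e = encode σ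
  P = 2 ^ (width σ + w)

-- The listing

ifZero-∸-≤ : ∀ {m n} a b → m ≤ n → ifZero (m ∸ n) a b ≡ a
ifZero-∸-≤ a b m≤n rewrite m≤n⇒m∸n≡0 m≤n = refl

ifZero-∸-> : ∀ {m n} a b → n < m → ifZero (m ∸ n) a b ≡ b
ifZero-∸-> {m} {n} a b n<m with m ∸ n | m>n⇒m∸n≢0 n<m
... | zero  | m∸n≢0 = contradiction refl m∸n≢0
... | suc _ | _     = refl

-- ⌊log₂ N⌋, with lg 0 = 0
lg : ℕ → ℕ
lg zero    = 0
lg (suc N) = ifZero (2 ^ suc (lg N) ∸ suc N) (suc (lg N)) (lg N)

lgᴾ : IsPrimRecᵛ 1 (unary lg)
lgᴾ = respᴾ (λ where (N ∷ []) → computes N)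
  (recᴾ zeroᴾ (compᴾ₃ ifZeroᴾ (compᴾ₂ monusᴾ (compᴾ₁ pow2ᴾ (sucᴾ (varᴾ (# 1)))) (sucᴾ (varᴾ (# 0))))
                              (sucᴾ (varᴾ (# 1))) (varᴾ (# 1))))
  where
  computes : ∀ N → recursion _ _ N [] ≡ lg N
  computes zero    = refl
  computes (suc N) = cong (λ l → ifZero (2 ^ suc l ∸ suc N) (suc l) l) (computes N)

lg-bounds : ∀ N → 2 ^ lg (suc N) ≤ suc N × suc N < 2 ^ suc (lg (suc N))
lg-bounds zero    = s≤s z≤n , s≤s (s≤s z≤n)
lg-bounds (suc N) with lg-bounds N | 2 ^ suc (lg (suc N)) ≤? suc (suc N)
... | _ , N<2^[1+l] | yes 2^[1+l]≤ rewrite ifZero-∸-≤ (suc (lg (suc N))) (lg (suc N)) 2^[1+l]≤ =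
  2^[1+l]≤ , ≤-<-trans N<2^[1+l] (^-monoʳ-< 2 (s≤s (s≤s z≤n)) (n<1+n (suc (lg (suc N)))))
... | 2^l≤ , _ | no 2^[1+l]≰ rewrite ifZero-∸-> (suc (lg (suc N))) (lg (suc N)) (≰⇒> 2^[1+l]≰) =
  ≤-trans 2^l≤ (n≤1+n _) , ≰⇒> 2^[1+l]≰

lg-unique : ∀ {N a} → 2 ^ a ≤ N → N < 2 ^ suc a → lg N ≡ a
lg-unique {zero}  {a} 2^a≤0 _ = contradiction 2^a≤0 (<⇒≱ (m^n>0 2 a))
lg-unique {suc N} {a} 2^a≤N N<2^[1+a] with lg-bounds N | <-cmp (lg (suc N)) a
... | _ , _ | tri≈ _ l≡a _ = l≡a
... | _ , N<2^[1+l] | tri< l<a _ _ =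
  contradiction (≤-trans (^-monoʳ-≤ 2 l<a) 2^a≤N) (<⇒≱ N<2^[1+l])
... | 2^l≤N , _ | tri> _ _ a<l =
  contradiction (≤-trans (^-monoʳ-≤ 2 a<l) 2^l≤N) (<⇒≱ N<2^[1+a])

-- A code N > 0 is read as rest N + 2 ^ lg N with rest N < 2 ^ lg N; by encode-∷ʳ, the code of σ ++ [ w ]
-- splits as encode σ + 2 ^ (width σ + w).
rest : ℕ → ℕ
rest N = N ∸ 2 ^ lg N

lg-split : ∀ {c m} → c < 2 ^ m → lg (c + 2 ^ m) ≡ m
lg-split {c} {m} c<2^m = lg-unique (m≤n+m _ c) (begin-strict
  c + 2 ^ m     <⟨ +-monoˡ-< (2 ^ m) c<2^m ⟩
  2 ^ m + 2 ^ m ≡⟨ cong (2 ^ m +_) (+-identityʳ _) ⟨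
  2 ^ suc m     ∎)
  where open ≤-Reasoning

rest-split : ∀ {c m} → c < 2 ^ m → rest (c + 2 ^ m) ≡ c
rest-split {c} {m} c<2^m =
  trans (cong (λ l → c + 2 ^ m ∸ 2 ^ l) (lg-split {c} {m} c<2^m)) (m+n∸n≡m c (2 ^ m))

rest+2^lg : ∀ N → 0 < N → rest N + 2 ^ lg N ≡ N
rest+2^lg (suc N) _ = m∸n+n≡m (proj₁ (lg-bounds N))

decode-split : ∀ N → rest N < lg N → ∃ λ σ → encode σ ≡ rest N × decode N ≡ σ ++ [ lg N ∸ width σ ]
decode-split (suc N) c<m with encode-surjective (rest (suc N))
... | σ , σ↦c = σ , σ↦c , trans (cong decode N≡) (decode-encode (σ ++ [ w ]))
  where
  w : ℕ
  w = lg (suc N) ∸ width σ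
  N≡ : suc N ≡ encode (σ ++ [ w ])
  N≡ = begin
    suc N                                   ≡⟨ rest+2^lg (suc N) z<s ⟨
    rest (suc N) + 2 ^ lg (suc N)           ≡⟨ cong₂ (λ c l → c + 2 ^ l) (sym σ↦c)
                                                 (sym (m+[n∸m]≡n (≤-trans (≤-trans (width≤encode σ) (≤-reflexive σ↦c)) (<⇒≤ c<m)))) ⟩
    encode σ + 2 ^ (width σ + w)            ≡⟨ encode-∷ʳ σ w ⟨
    encode (σ ++ [ w ])                     ∎
    where open ≡-Reasoning

gap : ℕ → ℕ
gap N = lg N ∸ rest N

-- 2 ^ n codes the string [ n ], and gap N is at most the last entry of the string coded by N.
listing : ℕ → ℕ → ℕ
listing n N = ifZero (gap N ∸ ack n (rest N)) (2 ^ n) N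

listing-accept : ∀ n N → ack n (rest N) < gap N → listing n N ≡ N
listing-accept n N = ifZero-∸-> (2 ^ n) N

listing-reject : ∀ n N → gap N ≤ ack n (rest N) → listing n N ≡ 2 ^ n
listing-reject n N = ifZero-∸-≤ (2 ^ n) N

restᴾ : IsPrimRecᵛ 1 (unary rest)
restᴾ = respᴾ (λ where (N ∷ []) → refl) (compᴾ₂ monusᴾ (varᴾ (# 0)) (compᴾ₁ pow2ᴾ (compᴾ₁ lgᴾ (varᴾ (# 0)))))

gapᴾ : IsPrimRecᵛ 1 (unary gap)
gapᴾ = respᴾ (λ where (N ∷ []) → refl) (compᴾ₂ monusᴾ (compᴾ₁ lgᴾ (varᴾ (# 0))) (compᴾ₁ restᴾ (varᴾ (# 0))))

m∸[n⊓m]≡m∸n : ∀ m n → m ∸ (n ⊓ m) ≡ m ∸ n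
m∸[n⊓m]≡m∸n m n = trans (∸-distribˡ-⊓-⊔ m n m) (trans (cong (m ∸ n ⊔_) (n∸n≡0 m)) (⊔-identityʳ (m ∸ n)))

listingᴾ : IsPrimRecᵛ 2 (binary listing)
listingᴾ = respᴾ (λ where (n ∷ N ∷ []) → cong (λ t → ifZero t (2 ^ n) N) (m∸[n⊓m]≡m∸n (gap N) (ack n (rest N))))
  (compᴾ₃ ifZeroᴾ (compᴾ₂ monusᴾ (compᴾ₁ gapᴾ codeᴾ) (compᴾ₃ ack⊓ᴾ (varᴾ (# 0)) (compᴾ₁ restᴾ codeᴾ) (compᴾ₁ gapᴾ codeᴾ)))
                  (compᴾ₁ pow2ᴾ (varᴾ (# 0))) codeᴾ)
  where
  codeᴾ : IsPrimRecᵛ 2 (λ v → lookup v (# 1))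
  codeᴾ = varᴾ (# 1)

G : PR 2
G = proj₁ listingᴾ

row-G : ∀ n N → row G n N ≡ listing n N
row-G n N = proj₂ listingᴾ (n ∷ N ∷ [])

≼-∷ʳ : ∀ σ (w : ℕ) → σ ≼ (σ ++ [ w ])
≼-∷ʳ []      w = []≼
≼-∷ʳ (a ∷ σ) w = ∷≼ (≼-∷ʳ σ w)

∈B-∷ʳ : ∀ {f σ w} → f ∈B (σ ++ [ w ]) → f (length σ) ≡ w
∈B-∷ʳ {f} {σ} {w} f∈ = ∷ʳ-injectiveʳ (map f (upTo (length σ))) σ (begin
  map f (upTo (length σ)) ∷ʳ f (length σ)   ≡⟨ map-++ f (upTo (length σ)) [ length σ ] ⟨
  map f (upTo (length σ) ∷ʳ length σ)      ≡⟨ cong (map f) (upTo-∷ʳ (length σ)) ⟩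
  map f (upTo (suc (length σ)))            ≡⟨ cong (λ k → map f (upTo k)) (trans (+-comm 1 _) (sym (length-++ σ))) ⟩
  map f (upTo (length (σ ++ [ w ])))       ≡⟨ f∈ ⟩
  σ ++ [ w ]                               ∎)
  where open ≡-Reasoning

listing-dense : ∀ n → Dense (row G n)
listing-dense n σ = σ ++ [ w ] , ≼-∷ʳ σ w , λ f f∈ → N , subst (f ∈B_) (sym decode-row) f∈
  where
  c w m N : ℕ
  c = encode σ
  w = c + suc (ack n c)
  m = width σ + w
  N = encode (σ ++ [ w ])
  c<2^m : c < 2 ^ m
  c<2^m = <-≤-trans (encode<2^width σ) (^-monoʳ-≤ 2 (m≤m+n (width σ) w))
  N≡ : N ≡ c + 2 ^ m
  N≡ = encode-∷ʳ σ w
  accepted : ack n (rest N) < gap N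
  accepted = subst₂ (λ r l → ack n r < l ∸ r) (sym (trans (cong rest N≡) (rest-split {c} {m} c<2^m)))
                                              (sym (trans (cong lg N≡) (lg-split {c} {m} c<2^m)))
    (begin-strict
      ack n c   <⟨ n<1+n _ ⟩
      suc (ack n c) ≡⟨ m+n∸m≡n c _ ⟨
      w ∸ c     ≤⟨ ∸-monoˡ-≤ c (m≤n+m w (width σ)) ⟩
      m ∸ c     ∎)
    where open ≤-Reasoning
  decode-row : decode (row G n N) ≡ σ ++ [ w ]
  decode-row = trans (cong decode (trans (row-G n N) (listing-accept n N accepted))) (decode-encode (σ ++ [ w ]))

listing-excludes : ∀ {f n} N → (∀ x → f x < ack n x) → f 0 < n → ¬ (f ∈B decode (listing n N))
listing-excludes {f} {n} N f<ack f0<n f∈ with ack n (rest N) <? gap N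
... | no rejected = <-irrefl f0≡n f0<n
  where
  f0≡n : f 0 ≡ n
  f0≡n = ∷-injectiveˡ (subst (f ∈B_) (trans (cong decode (listing-reject n N (≮⇒≥ rejected))) (decode-2^ n)) f∈)
... | yes accepted with decode-split N (m∸n≢0⇒n<m (λ gap≡0 → n≮0 (subst (ack n (rest N) <_) gap≡0 accepted)))
...   | σ , σ↦c , decode≡ = <-irrefl refl (begin-strict
  f (length σ)       <⟨ f<ack (length σ) ⟩
  ack n (length σ)   ≤⟨ ack-monoʳ-≤ n (≤-trans (length≤width σ) width≤c) ⟩
  ack n (rest N)     <⟨ accepted ⟩
  lg N ∸ rest N      ≤⟨ ∸-monoʳ-≤ (lg N) width≤c ⟩
  lg N ∸ width σ     ≡⟨ fL≡w ⟨
  f (length σ)       ∎)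
  where
  open ≤-Reasoning
  width≤c : width σ ≤ rest N
  width≤c = ≤-trans (width≤encode σ) (≤-reflexive σ↦c)
  fL≡w : f (length σ) ≡ lg N ∸ width σ
  fL≡w = ∈B-∷ʳ (subst (f ∈B_) (trans (cong decode (listing-accept n N accepted)) decode≡) f∈)

row-avoids : ∀ {f n} → (∀ x → f x < ack n x) → f 0 < n → ¬ (f ∈O row G n)
row-avoids {f} {n} f<ack f0<n (N , f∈row) =
  listing-excludes N f<ack f0<n (subst (λ K → f ∈B decode K) (row-G n N) f∈row)

mainTheorem4 : Σ (PR 2) λ G →
    ((n : _) → Dense (row G n)) ×
    ((f : _) → IsPrimRec f → ¬ ((n : _) → f ∈O row G n))
mainTheorem4 = G , listing-dense , escapes
  where
  escapes : ∀ f → IsPrimRec f → ¬ (∀ n → f ∈O row G n)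
  escapes f f-pr f∈⋂ =
    let m , f<ack = primRec<ack f-pr in
    row-avoids (λ x → <-≤-trans (f<ack x) (ack-monoˡ-≤ x (m≤m⊔n m (suc (f 0)))))
               (m≤n⊔m m (suc (f 0)))
               (f∈⋂ (m ⊔ suc (f 0)))
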